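{- Let $D$ be a $(2,2)$ digraph and $G=CCE(D)$. Suppose $G$ has a cycle $C$ of length $m$ for some $m\ge 3$. Then $|N^+(C)\cup N^-(C)|\ge m+3$ and $|N^+(C)\cap N^-(C)|\le m-3$, where $N^{\pm}(C)$ means $N^{\pm}(V(C))$ computed in $D$.
   Context: All graphs and digraphs are simple (no loops, no multiple arcs). In a digraph $D$, if $(u,x)$ is an arc then $x$ is a prey of $u$ and $u$ is a predator of $x$. The CCE graph $CCE(D)$ of $D$ is the graph on $V(D)$ in which distinct $u,v$ are adjacent iff they have a common prey and a common predator in $D$. A $(2,2)$ digraph is an acyclic digraph in which every vertex has indegree at most $2$ and outdegree at most $2$. For $X\subseteq V(D)$, $N^+(X)=\{v\in V(D)\setminus X : (x,v)\in A(D)\text{ for some }x\in X\}$ and $N^-(X)=\{v\in V(D)\setminus X : (v,x)\in A(D)\text{ for some }x\in X\}$. -}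

module Defs where

open import Data.Nat using (ℕ; zero; suc; _≤_)
open import Data.Nat.DivMod using (_mod_)
open import Data.Bool using (Bool; true; false; _∧_; _∨_; not)
open import Data.Fin using (Fin; toℕ; _≟_)
open import Data.Fin.Subset using (Subset)
open import Data.Vec using (tabulate)
open import Data.Product using (Σ; _×_; ∃)
open import Relation.Binary.PropositionalEquality using (_≡_; _≢_)
open import Relation.Nullary using (¬_; does)
open import Function.Definitions using (Injective)

record Digraph (n : ℕ) : Set where
  field
    arc   : Fin n → Fin n → Bool
    loopless : ∀ v → arc v v ≡ false
open Digraph public

anyFin : ∀ {m} → (Fin m → Bool) → Bool
anyFin {zero}  f = false
anyFin {suc m} f = f Fin.zero ∨ anyFin (λ i → f (Fin.suc i))

countFin : ∀ {m} → (Fin m → Bool) → ℕ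
countFin {zero}  f = zero
countFin {suc m} f with f Fin.zero
... | true  = suc (countFin (λ i → f (Fin.suc i)))
... | false = countFin (λ i → f (Fin.suc i))

outdeg indeg : ∀ {n} → Digraph n → Fin n → ℕ
outdeg D v = countFin (λ w → arc D v w)
indeg  D v = countFin (λ u → arc D u v)

data Reach {n} (D : Digraph n) : Fin n → Fin n → Set where
  step : ∀ {u v} → arc D u v ≡ true → Reach D u v
  _⨾_  : ∀ {u v w} → Reach D u v → Reach D v w → Reach D u w

Acyclic : ∀ {n} → Digraph n → Set
Acyclic D = ∀ v → ¬ Reach D v v

Is22 : ∀ {n} → Digraph n → Set
Is22 D = Acyclic D × (∀ v → indeg D v ≤ 2) × (∀ v → outdeg D v ≤ 2)

CCEAdj : ∀ {n} → Digraph n → Fin n → Fin n → Set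
CCEAdj D u v = u ≢ v
             × (∃ λ w → arc D u w ≡ true × arc D v w ≡ true)
             × (∃ λ z → arc D z u ≡ true × arc D z v ≡ true)

next : ∀ {m} → Fin m → Fin m
next {suc k} i = suc (toℕ i) mod suc k

IsCCECycle : ∀ {n} → Digraph n → (m : ℕ) → (Fin m → Fin n) → Set
IsCCECycle D m c = 3 ≤ m × Injective _≡_ _≡_ c × (∀ i → CCEAdj D (c i) (c (next i)))

inV : ∀ {n m} → (Fin m → Fin n) → Fin n → Bool
inV c x = anyFin (λ i → does (c i ≟ x))

N⁺ N⁻ : ∀ {n m} → Digraph n → (Fin m → Fin n) → Subset n
N⁺ D c = tabulate (λ x → not (inV c x) ∧ anyFin (λ i → arc D (c i) x))
N⁻ D c = tabulate (λ x → not (inV c x) ∧ anyFin (λ i → arc D x (c i)))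

-- Let w i and z i be a common prey and a common predator of the consecutive cycle vertices c i
-- and c (i+1). Since all degrees are at most 2, the preys of c i are exactly w i and w (i-1);
-- hence the w i are pairwise distinct and are all the out-neighbours of the cycle. None of them
-- lies on the cycle: if one did, all would, and following the arcs c i ⟶ w i forever would
-- contradict acyclicity. So |N⁺(C)| ≥ m, and dually |N⁻(C)| ≥ m. Now pick a cycle vertex c a that
-- is not the end of a two-arc walk from the cycle, and a second one c a′ that is not the end of
-- such a walk from the cycle minus c a. A predator z e of c a or c a′ cannot be a prey w i of the
-- cycle, for c i ⟶ w i ⟶ c a (or one of c i, c (i+1) ⟶ w i ⟶ c a′) would be such a walk. At
-- least three indices e have z e ⟶ c a or c a′, so |N⁺(C) ∩ N⁻(C)| ≤ m − 3, and
-- inclusion–exclusion gives |N⁺(C) ∪ N⁻(C)| ≥ m + 3.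
module Submission where

open import Data.Bool using (Bool; true; false; _∧_; not)
open import Data.Bool.Properties using () renaming (_≟_ to _≟ᵇ_)
open import Data.Empty using (⊥; ⊥-elim)
open import Data.Fin using (Fin; zero; suc; toℕ; fromℕ; inject₁; _≟_)
open import Data.Fin.Induction
  using (spo-wellFounded; spo-noetherian; <-weakInduction; <-weakInduction-startingFrom)
open import Data.Fin.Properties
  using (any?; ¬Fin0; 0≢1+n; suc-injective; toℕ-injective; toℕ<n; toℕ-fromℕ; toℕ-fromℕ<;
         toℕ-inject₁; ≤fromℕ)
open import Data.Fin.Relation.Unary.Top using (view; ‵fromℕ; ‵inj₁)
open import Data.Fin.Subset
  using (Subset; inside; outside; _∈_; _∉_; _⊆_; ∣_∣; _∪_; _∩_; ∁; _─_; _-_; ⁅_⁆)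
  renaming (⊥ to ∅)
open import Data.Fin.Subset.Properties
  using (drop-there; x∈⁅x⁆; ∣⁅x⁆∣≡1; ∣⊥∣≡0; p⊆q⇒∣p∣≤∣q∣; x∈p∪q⁺; x∈p∪q⁻; x∈p∩q⁻;
         x∉p⇒x∈∁p; ∣∁p∣≡n∸∣p∣; p─q⊆p; x∈p∧x≢y⇒x∈p-y; x∈p⇒∣p-x∣<∣p∣)
open import Data.Nat using (ℕ; zero; suc; _+_; _∸_; _≤_; z≤n; s≤s)
open import Data.Nat.DivMod using (_%_; m<n⇒m%n≡m; n%n≡0)
open import Data.Nat.Properties
  using (≤-trans; ≤-reflexive; <⇒≤; <⇒≢; ≤⇒≯; 1+n≢n; m≢1+n+m; +-comm; +-assoc; +-suc; m≤m+n;
         +-mono-≤; +-monoʳ-≤; +-cancelʳ-≤; m+[n∸m]≡n; ∸-monoʳ-≤; module ≤-Reasoning)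
open import Data.Product using (∃; ∃₂; _×_; _,_; proj₁; proj₂)
open import Data.Sum using (_⊎_; inj₁; inj₂)
open import Data.Unit using (⊤; tt)
open import Data.Vec using (tabulate; []; _∷_; here; there)
open import Data.Vec.Properties using (lookup∘tabulate; []=⇒lookup; lookup⇒[]=)
open import Function using (_∘_; flip)
open import Function.Definitions using (Injective)
open import Induction.WellFounded using (WellFounded; Acc; acc; module Subrelation)
open import Level using (0ℓ)
open import Relation.Binary.Core using (Rel)
open import Relation.Binary.Definitions using (Decidable)
open import Relation.Binary.PropositionalEquality
open import Relation.Binary.Structures using (IsStrictPartialOrder)
open import Relation.Nullary using (¬_; yes; no; ¬?)
open import Relation.Nullary.Decidable using (_×-dec_)
open import Relation.Unary using (Pred)
import Relation.Unary as U

open import Defs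

∧-≡-trueʳ : ∀ a {b} → a ∧ b ≡ true → b ≡ true
∧-≡-trueʳ true a∧b = a∧b

anyFin⇒∃ : ∀ {m} {f : Fin m → Bool} → anyFin f ≡ true → ∃ λ i → f i ≡ true
anyFin⇒∃ {suc m} {f} any-f with f zero in f₀
... | true  = zero , f₀
... | false = let i , fᵢ = anyFin⇒∃ any-f in suc i , fᵢ

∃⇒anyFin : ∀ {m} {f : Fin m → Bool} i → f i ≡ true → anyFin f ≡ true
∃⇒anyFin {f = f} zero    fᵢ rewrite fᵢ = refl
∃⇒anyFin {f = f} (suc i) fᵢ with f zero
... | true  = refl
... | false = ∃⇒anyFin i fᵢ

∈tabulate⁺ : ∀ {n} (f : Fin n → Bool) {x} → f x ≡ true → x ∈ tabulate f
∈tabulate⁺ f {x} fx = lookup⇒[]= x _ (trans (lookup∘tabulate f x) fx)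

∈tabulate⁻ : ∀ {n} (f : Fin n → Bool) {x} → x ∈ tabulate f → f x ≡ true
∈tabulate⁻ f {x} x∈ = trans (sym (lookup∘tabulate f x)) ([]=⇒lookup x∈)

countFin≡∣tabulate∣ : ∀ {m} (f : Fin m → Bool) → countFin f ≡ ∣ tabulate f ∣
countFin≡∣tabulate∣ {zero}  f = refl
countFin≡∣tabulate∣ {suc m} f with f zero
... | true  = cong suc (countFin≡∣tabulate∣ (f ∘ suc))
... | false = countFin≡∣tabulate∣ (f ∘ suc)

3≤∣p∣ : ∀ {n} {p : Subset n} {x y z} → x ∈ p → y ∈ p → z ∈ p →
        x ≢ y → x ≢ z → y ≢ z → 3 ≤ ∣ p ∣
3≤∣p∣ x∈p y∈p z∈p x≢y x≢z y≢z =
  ≤-trans (s≤s (≤-trans (s≤s 1≤∣p-x-y∣) (x∈p⇒∣p-x∣<∣p∣ y∈p-x))) (x∈p⇒∣p-x∣<∣p∣ x∈p)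
  where
  y∈p-x   = x∈p∧x≢y⇒x∈p-y y∈p (x≢y ∘ sym)
  z∈p-x-y = x∈p∧x≢y⇒x∈p-y (x∈p∧x≢y⇒x∈p-y z∈p (x≢z ∘ sym)) (y≢z ∘ sym)
  1≤∣p-x-y∣ = ≤-trans (s≤s z≤n) (x∈p⇒∣p-x∣<∣p∣ z∈p-x-y)

countFin≤2⇒¬three : ∀ {m} {f : Fin m → Bool} → countFin f ≤ 2 → ∀ {x y z} →
                    f x ≡ true → f y ≡ true → f z ≡ true → x ≢ y → x ≢ z → y ≢ z → ⊥
countFin≤2⇒¬three {f = f} countFin≤2 fx fy fz x≢y x≢z y≢z = ≤⇒≯ countFin≤2 (begin
  3               ≤⟨ 3≤∣p∣ (∈tabulate⁺ f fx) (∈tabulate⁺ f fy) (∈tabulate⁺ f fz) x≢y x≢z y≢z ⟩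
  ∣ tabulate f ∣  ≡⟨ countFin≡∣tabulate∣ f ⟨
  countFin f      ∎)
  where open ≤-Reasoning

injective⇒≤∣p∣ : ∀ {k n} {p : Subset n} (e : Fin k → Fin n) → Injective _≡_ _≡_ e →
                 (∀ i → e i ∈ p) → k ≤ ∣ p ∣
injective⇒≤∣p∣ {zero}  e e-injective e∈p = z≤n
injective⇒≤∣p∣ {suc k} e e-injective e∈p = ≤-trans
  (s≤s (injective⇒≤∣p∣ (e ∘ suc) (suc-injective ∘ e-injective) eₛᵤ꜀∈p-e₀))
  (x∈p⇒∣p-x∣<∣p∣ (e∈p zero))
  where
  eₛᵤ꜀∈p-e₀ : ∀ i → e (suc i) ∈ _ - e zero
  eₛᵤ꜀∈p-e₀ i = x∈p∧x≢y⇒x∈p-y (e∈p (suc i)) (0≢1+n ∘ sym ∘ e-injective)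

∣p∪q∣+∣p∩q∣≡∣p∣+∣q∣ : ∀ {n} (p q : Subset n) → ∣ p ∪ q ∣ + ∣ p ∩ q ∣ ≡ ∣ p ∣ + ∣ q ∣
∣p∪q∣+∣p∩q∣≡∣p∣+∣q∣ []            []            = refl
∣p∪q∣+∣p∩q∣≡∣p∣+∣q∣ (inside  ∷ p) (inside  ∷ q) =
  cong suc (trans (+-suc _ _) (trans (cong suc (∣p∪q∣+∣p∩q∣≡∣p∣+∣q∣ p q)) (sym (+-suc _ _))))
∣p∪q∣+∣p∩q∣≡∣p∣+∣q∣ (inside  ∷ p) (outside ∷ q) = cong suc (∣p∪q∣+∣p∩q∣≡∣p∣+∣q∣ p q)
∣p∪q∣+∣p∩q∣≡∣p∣+∣q∣ (outside ∷ p) (inside  ∷ q) =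
  trans (cong suc (∣p∪q∣+∣p∩q∣≡∣p∣+∣q∣ p q)) (sym (+-suc _ _))
∣p∪q∣+∣p∩q∣≡∣p∣+∣q∣ (outside ∷ p) (outside ∷ q) = ∣p∪q∣+∣p∩q∣≡∣p∣+∣q∣ p q

∣p∪q∣≤∣p∣+∣q∣ : ∀ {n} (p q : Subset n) → ∣ p ∪ q ∣ ≤ ∣ p ∣ + ∣ q ∣
∣p∪q∣≤∣p∣+∣q∣ p q = ≤-trans (m≤m+n _ _) (≤-reflexive (∣p∪q∣+∣p∩q∣≡∣p∣+∣q∣ p q))

m+3≤∣p∪q∣ : ∀ {n m} (p q : Subset n) → m ≤ ∣ p ∣ → m ≤ ∣ q ∣ → ∣ p ∩ q ∣ ≤ m ∸ 3 → 3 ≤ m →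
            m + 3 ≤ ∣ p ∪ q ∣
m+3≤∣p∪q∣ {m = m} p q m≤∣p∣ m≤∣q∣ ∣p∩q∣≤m∸3 3≤m = +-cancelʳ-≤ (∣ p ∩ q ∣) (m + 3) (∣ p ∪ q ∣) (begin
  m + 3 + ∣ p ∩ q ∣      ≤⟨ +-monoʳ-≤ (m + 3) ∣p∩q∣≤m∸3 ⟩
  m + 3 + (m ∸ 3)        ≡⟨ +-assoc m 3 (m ∸ 3) ⟩
  m + (3 + (m ∸ 3))      ≡⟨ cong (m +_) (m+[n∸m]≡n 3≤m) ⟩
  m + m                  ≤⟨ +-mono-≤ m≤∣p∣ m≤∣q∣ ⟩
  ∣ p ∣ + ∣ q ∣          ≡⟨ ∣p∪q∣+∣p∩q∣≡∣p∣+∣q∣ p q ⟨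
  ∣ p ∪ q ∣ + ∣ p ∩ q ∣  ∎)
  where open ≤-Reasoning

x∈p─q⇒x∉q : ∀ {n} (p q : Subset n) {x} → x ∈ p ─ q → x ∉ q
x∈p─q⇒x∉q (_ ∷ p) (inside  ∷ q) ()         here
x∈p─q⇒x∉q (_ ∷ p) (inside  ∷ q) (there x∈) (there x∈q) = x∈p─q⇒x∉q p q x∈ x∈q
x∈p─q⇒x∉q (_ ∷ p) (outside ∷ q) (there x∈) (there x∈q) = x∈p─q⇒x∉q p q x∈ x∈q

x∈p-y⇒x≢y : ∀ {n} {p : Subset n} {x y} → x ∈ p - y → x ≢ y
x∈p-y⇒x≢y {p = p} {x} x∈ refl = x∈p─q⇒x∉q p ⁅ x ⁆ x∈ (x∈⁅x⁆ x)

∣p∣≤1+∣p-x∣ : ∀ {n} (p : Subset n) x → ∣ p ∣ ≤ suc ∣ p - x ∣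
∣p∣≤1+∣p-x∣ p x = begin
  ∣ p ∣                  ≤⟨ p⊆q⇒∣p∣≤∣q∣ p⊆[p-x]∪⁅x⁆ ⟩
  ∣ (p - x) ∪ ⁅ x ⁆ ∣    ≤⟨ ∣p∪q∣≤∣p∣+∣q∣ (p - x) ⁅ x ⁆ ⟩
  ∣ p - x ∣ + ∣ ⁅ x ⁆ ∣  ≡⟨ cong (∣ p - x ∣ +_) (∣⁅x⁆∣≡1 x) ⟩
  ∣ p - x ∣ + 1          ≡⟨ +-comm ∣ p - x ∣ 1 ⟩
  suc ∣ p - x ∣          ∎
  where
  open ≤-Reasoning
  p⊆[p-x]∪⁅x⁆ : p ⊆ (p - x) ∪ ⁅ x ⁆
  p⊆[p-x]∪⁅x⁆ {y} y∈p with y ≟ x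
  ... | yes refl = x∈p∪q⁺ (inj₂ (x∈⁅x⁆ y))
  ... | no  y≢x  = x∈p∪q⁺ (inj₁ (x∈p∧x≢y⇒x∈p-y y∈p y≢x))

covered⇒∣p∣≤∣q∣ : ∀ {k n} {p : Subset n} {q : Subset k} (e : Fin k → Fin n) →
                  (∀ {x} → x ∈ p → ∃ λ i → i ∈ q × e i ≡ x) → ∣ p ∣ ≤ ∣ q ∣
covered⇒∣p∣≤∣q∣ {n = n} {q = []} e cover =
  ≤-trans (p⊆q⇒∣p∣≤∣q∣ {q = ∅} (⊥-elim ∘ ¬Fin0 ∘ proj₁ ∘ cover)) (≤-reflexive (∣⊥∣≡0 n))
covered⇒∣p∣≤∣q∣ {p = p} {q = outside ∷ q} e cover = covered⇒∣p∣≤∣q∣ (e ∘ suc) cover′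
  where
  cover′ : ∀ {x} → x ∈ p → ∃ λ i → i ∈ q × e (suc i) ≡ x
  cover′ x∈p with cover x∈p
  ... | suc i , i∈ , eᵢ≡x = i , drop-there i∈ , eᵢ≡x
covered⇒∣p∣≤∣q∣ {p = p} {q = inside ∷ q} e cover =
  ≤-trans (∣p∣≤1+∣p-x∣ p (e zero)) (s≤s (covered⇒∣p∣≤∣q∣ (e ∘ suc) cover′))
  where
  cover′ : ∀ {x} → x ∈ p - e zero → ∃ λ i → i ∈ q × e (suc i) ≡ x
  cover′ x∈ with cover (p─q⊆p p ⁅ e zero ⁆ x∈)
  ... | zero  , _  , e₀≡x = ⊥-elim (x∈p-y⇒x≢y x∈ (sym e₀≡x))
  ... | suc i , i∈ , eᵢ≡x = i , drop-there i∈ , eᵢ≡x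

prev : ∀ {k} → Fin (suc k) → Fin (suc k)
prev zero    = fromℕ _
prev (suc i) = inject₁ i

toℕ-next : ∀ {k} (i : Fin (suc k)) → toℕ (next i) ≡ suc (toℕ i) % suc k
toℕ-next i = toℕ-fromℕ< _

next-inject₁ : ∀ {k} (i : Fin k) → next (inject₁ i) ≡ suc i
next-inject₁ {k} i = toℕ-injective (begin
  toℕ (next (inject₁ i))         ≡⟨ toℕ-next (inject₁ i) ⟩
  suc (toℕ (inject₁ i)) % suc k  ≡⟨ cong (λ t → suc t % suc k) (toℕ-inject₁ i) ⟩
  suc (toℕ i) % suc k            ≡⟨ m<n⇒m%n≡m (s≤s (toℕ<n i)) ⟩
  suc (toℕ i)                    ∎)
  where open ≡-Reasoning

next-fromℕ : ∀ k → next (fromℕ k) ≡ zero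
next-fromℕ k = toℕ-injective (begin
  toℕ (next (fromℕ k))         ≡⟨ toℕ-next (fromℕ k) ⟩
  suc (toℕ (fromℕ k)) % suc k  ≡⟨ cong (λ t → suc t % suc k) (toℕ-fromℕ k) ⟩
  suc k % suc k                ≡⟨ n%n≡0 (suc k) ⟩
  0                            ∎)
  where open ≡-Reasoning

next-prev : ∀ {k} (i : Fin (suc k)) → next (prev i) ≡ i
next-prev zero    = next-fromℕ _
next-prev (suc i) = next-inject₁ i

prev-next : ∀ {k} (i : Fin (suc k)) → prev (next i) ≡ i
prev-next i with view i
... | ‵fromℕ          = cong prev (next-fromℕ _)
... | ‵inj₁ {i = j} _ = cong prev (next-inject₁ j)

next-induction : ∀ {k p} (P : Pred (Fin (suc k)) p) {i} → P i →
                 (∀ j → P j → P (next j)) → ∀ j → P j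
next-induction P Pᵢ P⇒P∘next = <-weakInduction P P₀ P∘inject₁⇒P∘suc
  where
  P∘inject₁⇒P∘suc : ∀ j → P (inject₁ j) → P (suc j)
  P∘inject₁⇒P∘suc j = subst P (next-inject₁ j) ∘ P⇒P∘next (inject₁ j)
  P₀ = subst P (next-fromℕ _)
         (P⇒P∘next _ (<-weakInduction-startingFrom P Pᵢ P∘inject₁⇒P∘suc (≤fromℕ _)))

next-cases : ∀ {k} (i : Fin (suc k)) →
             toℕ (next i) ≡ suc (toℕ i) ⊎ (toℕ i ≡ k × next i ≡ zero)
next-cases i with view i
... | ‵fromℕ          = inj₂ (toℕ-fromℕ _ , next-fromℕ _)
... | ‵inj₁ {i = j} _ = inj₁ (trans (cong toℕ (next-inject₁ j)) (cong suc (sym (toℕ-inject₁ j))))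

next≢ : ∀ {k} → 1 ≤ k → (i : Fin (suc k)) → next i ≢ i
next≢ 1≤k i next≡i with next-cases i
... | inj₁ next≡1+i        = 1+n≢n (trans (sym next≡1+i) (cong toℕ next≡i))
... | inj₂ (i≡k , next≡0) = <⇒≢ 1≤k (sym (trans (sym i≡k) (cong toℕ (trans (sym next≡i) next≡0))))

next²≢ : ∀ {k} → 2 ≤ k → (i : Fin (suc k)) → next (next i) ≢ i
next²≢ 2≤k i next²≡i with next-cases i | next-cases (next i)
... | inj₁ next≡1+i | inj₁ next²≡1+next =
  m≢1+n+m (toℕ i) (trans (sym (cong toℕ next²≡i)) (trans next²≡1+next (cong suc next≡1+i)))
... | inj₁ next≡1+i | inj₂ (next≡k , next²≡0) =
  <⇒≢ 2≤k (sym (trans (sym next≡k) (trans next≡1+i (cong (suc ∘ toℕ) (trans (sym next²≡i) next²≡0)))))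
... | inj₂ (i≡k , next≡0) | inj₁ next²≡1+next =
  <⇒≢ 2≤k (sym (trans (sym i≡k)
    (trans (cong toℕ (sym next²≡i)) (trans next²≡1+next (cong (suc ∘ toℕ) next≡0)))))
... | inj₂ (_ , next≡0) | inj₂ (next≡k , _) =
  <⇒≢ (<⇒≤ 2≤k) (sym (trans (sym next≡k) (cong toℕ next≡0)))

prev≢ : ∀ {k} → 1 ≤ k → (i : Fin (suc k)) → prev i ≢ i
prev≢ 1≤k i prev≡i = next≢ 1≤k i (trans (cong next (sym prev≡i)) (next-prev i))

next≢prev : ∀ {k} → 2 ≤ k → (i : Fin (suc k)) → next i ≢ prev i
next≢prev 2≤k i next≡prev = next²≢ 2≤k (prev i) (trans (cong next (next-prev i)) next≡prev)

prev²≢ : ∀ {k} → 2 ≤ k → (i : Fin (suc k)) → prev (prev i) ≢ i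
prev²≢ 2≤k i prev²≡i =
  next²≢ 2≤k (prev (prev i)) (trans (cong next (next-prev (prev i))) (trans (next-prev i) (sym prev²≡i)))

prev-pairs⇒3≤∣p∣ : ∀ {k} → 2 ≤ k → {p : Subset (suc k)} {a b : Fin (suc k)} → b ≢ a →
                   a ∈ p → prev a ∈ p → b ∈ p → prev b ∈ p → 3 ≤ ∣ p ∣
prev-pairs⇒3≤∣p∣ 2≤k {a = a} {b} b≢a a∈p a⁻∈p b∈p b⁻∈p with b ≟ prev a
... | yes refl = 3≤∣p∣ a∈p a⁻∈p b⁻∈p
                   (prev≢ (<⇒≤ 2≤k) a ∘ sym) (prev²≢ 2≤k a ∘ sym) (prev≢ (<⇒≤ 2≤k) b ∘ sym)
... | no b≢a⁻  = 3≤∣p∣ a∈p a⁻∈p b∈p (prev≢ (<⇒≤ 2≤k) a ∘ sym) (b≢a ∘ sym) (b≢a⁻ ∘ sym)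

wf⇒∃-minimal : ∀ {m ℓ q} {_<_ : Rel (Fin m) ℓ} → WellFounded _<_ → Decidable _<_ →
               {Q : Pred (Fin m) q} → U.Decidable Q →
               ∀ {y} → Q y → ∃ λ a → Q a × ∀ {u} → Q u → ¬ u < a
wf⇒∃-minimal {_<_ = _<_} wf _<?_ {Q} Q? {y} Qy = go (wf y) Qy
  where
  go : ∀ {y} → Acc _<_ y → Q y → ∃ λ a → Q a × ∀ {u} → Q u → ¬ u < a
  go {y} (acc rs) Qy with any? (λ u → Q? u ×-dec u <? y)
  ... | yes (u , Qu , u<y) = go (rs u<y) Qu
  ... | no ∄u              = y , Qy , λ Qu u<y → ∄u (_ , Qu , u<y)

module Arcs {n} (D : Digraph n) where

  infix 4 _⟶_
  _⟶_ : Fin n → Fin n → Set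
  u ⟶ v = arc D u v ≡ true

reverse : ∀ {n} → Digraph n → Digraph n
reverse D = record { arc = flip (arc D) ; loopless = loopless D }

Reach-reverse : ∀ {n} {D : Digraph n} {u v} → Reach (reverse D) u v → Reach D v u
Reach-reverse (step v⟶u) = step v⟶u
Reach-reverse (r ⨾ s)    = Reach-reverse s ⨾ Reach-reverse r

reverse-acyclic : ∀ {n} {D : Digraph n} → Acyclic D → Acyclic (reverse D)
reverse-acyclic acyclic v = acyclic v ∘ Reach-reverse

not-inV : ∀ {n m} {c : Fin m → Fin n} {x} → (∀ i → c i ≢ x) → not (inV c x) ≡ true
not-inV {c = c} {x} x∉c with inV c x in x∈c
... | false = refl
... | true with anyFin⇒∃ x∈c
...   | i , cᵢ≟x with c i ≟ x
...     | yes cᵢ≡x = ⊥-elim (x∉c i cᵢ≡x)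

∈N⁺⁻ : ∀ {n m} (D : Digraph n) (c : Fin m → Fin n) {x} → x ∈ N⁺ D c →
       ∃ λ i → arc D (c i) x ≡ true
∈N⁺⁻ D c {x} x∈N⁺ = anyFin⇒∃ (∧-≡-trueʳ (not (inV c x)) (∈tabulate⁻ _ x∈N⁺))

∈N⁺⁺ : ∀ {n m} (D : Digraph n) (c : Fin m → Fin n) {x} i → (∀ j → c j ≢ x) →
       arc D (c i) x ≡ true → x ∈ N⁺ D c
∈N⁺⁺ D c i x∉c cᵢ⟶x = ∈tabulate⁺ _ (cong₂ _∧_ (not-inV x∉c) (∃⇒anyFin i cᵢ⟶x))

module ReachOrder {n} (D : Digraph n) (acyclic : Acyclic D) {m} (c : Fin m → Fin n) where

  open Arcs D

  _≺_ : Rel (Fin m) 0ℓ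
  i ≺ j = Reach D (c i) (c j)

  ≺-isStrictPartialOrder : IsStrictPartialOrder _≡_ _≺_
  ≺-isStrictPartialOrder = record
    { isEquivalence = isEquivalence
    ; irrefl        = λ { refl → acyclic _ }
    ; trans         = _⨾_
    ; <-resp-≈      = resp₂ _≺_
    }

  ¬≺-inflationary : (s : Fin m → Fin m) → (∀ i → i ≺ s i) → ¬ Fin m
  ¬≺-inflationary s i≺sᵢ i = go (spo-noetherian ≺-isStrictPartialOrder i)
    where
    go : ∀ {i} → Acc (flip _≺_) i → ⊥
    go {i} (acc rs) = go (rs (i≺sᵢ i))

  -- Walks of length two: unlike _≺_ this is decidable, so it has minimal elements constructively.
  _⇝_ : Rel (Fin m) 0ℓ
  i ⇝ j = ∃ λ x → c i ⟶ x × x ⟶ c j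

  _⇝?_ : Decidable _⇝_
  i ⇝? j = any? λ x → (arc D (c i) x ≟ᵇ true) ×-dec (arc D x (c j) ≟ᵇ true)

  ⇝-wellFounded : WellFounded _⇝_
  ⇝-wellFounded = Subrelation.wellFounded (λ (_ , i⟶x , x⟶j) → step i⟶x ⨾ step x⟶j)
                    (spo-wellFounded ≺-isStrictPartialOrder)

module CyclePreys {n} (D : Digraph n)
                  (indeg≤2 : ∀ v → indeg D v ≤ 2) (outdeg≤2 : ∀ v → outdeg D v ≤ 2)
                  {k} (2≤k : 2 ≤ k) (c : Fin (suc k) → Fin n) (c-injective : Injective _≡_ _≡_ c)
                  (w : Fin (suc k) → Fin n)
                  (cᵢ⟶wᵢ : ∀ i → arc D (c i) (w i) ≡ true)
                  (cᵢ₊₁⟶wᵢ : ∀ i → arc D (c (next i)) (w i) ≡ true) where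

  open Arcs D

  private
    1≤k : 1 ≤ k
    1≤k = <⇒≤ 2≤k

    c-≢ : ∀ {i j} → i ≢ j → c i ≢ c j
    c-≢ i≢j = i≢j ∘ c-injective

    no-three-predators : ∀ {x u₁ u₂ u₃} → u₁ ⟶ x → u₂ ⟶ x → u₃ ⟶ x →
                         u₁ ≢ u₂ → u₁ ≢ u₃ → u₂ ≢ u₃ → ⊥
    no-three-predators = countFin≤2⇒¬three (indeg≤2 _)

    no-three-preys : ∀ {x v₁ v₂ v₃} → x ⟶ v₁ → x ⟶ v₂ → x ⟶ v₃ →
                     v₁ ≢ v₂ → v₁ ≢ v₃ → v₂ ≢ v₃ → ⊥
    no-three-preys = countFin≤2⇒¬three (outdeg≤2 _)

    cᵢ⟶wᵢ₋₁ : ∀ i → c i ⟶ w (prev i)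
    cᵢ⟶wᵢ₋₁ i = subst (λ j → c j ⟶ w (prev i)) (next-prev i) (cᵢ₊₁⟶wᵢ (prev i))

    wᵢ≢wᵢ₋₁ : ∀ i → w i ≢ w (prev i)
    wᵢ≢wᵢ₋₁ i wᵢ≡wᵢ₋₁ =
      no-three-predators (cᵢ⟶wᵢ i) (cᵢ₊₁⟶wᵢ i) (subst (c (prev i) ⟶_) (sym wᵢ≡wᵢ₋₁) (cᵢ⟶wᵢ (prev i)))
        (c-≢ (next≢ 1≤k i ∘ sym)) (c-≢ (prev≢ 1≤k i ∘ sym)) (c-≢ (next≢prev 2≤k i))

  prey-of-cycle : ∀ i {x} → c i ⟶ x → x ≡ w i ⊎ x ≡ w (prev i)
  prey-of-cycle i {x} cᵢ⟶x with x ≟ w i | x ≟ w (prev i)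
  ... | yes x≡wᵢ | _          = inj₁ x≡wᵢ
  ... | no  _    | yes x≡wᵢ₋₁ = inj₂ x≡wᵢ₋₁
  ... | no x≢wᵢ  | no x≢wᵢ₋₁  =
    ⊥-elim (no-three-preys cᵢ⟶x (cᵢ⟶wᵢ i) (cᵢ⟶wᵢ₋₁ i) x≢wᵢ x≢wᵢ₋₁ (wᵢ≢wᵢ₋₁ i))

  w-injective : Injective _≡_ _≡_ w
  w-injective {i} {j} wᵢ≡wⱼ with i ≟ j
  ... | yes i≡j = i≡j
  ... | no i≢j with j ≟ next i
  ...   | yes refl = ⊥-elim (no-three-predators
            (cᵢ⟶wᵢ i) (cᵢ₊₁⟶wᵢ i) (subst (c (next j) ⟶_) (sym wᵢ≡wⱼ) (cᵢ₊₁⟶wᵢ j))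
            (c-≢ (next≢ 1≤k i ∘ sym)) (c-≢ (next²≢ 2≤k i ∘ sym)) (c-≢ (next≢ 1≤k j ∘ sym)))
  ...   | no j≢next = ⊥-elim (no-three-predators
            (cᵢ⟶wᵢ i) (cᵢ₊₁⟶wᵢ i) (subst (c j ⟶_) (sym wᵢ≡wⱼ) (cᵢ⟶wᵢ j))
            (c-≢ (next≢ 1≤k i ∘ sym)) (c-≢ i≢j) (c-≢ (j≢next ∘ sym)))

  N⁺⊆w : ∀ {x} → x ∈ N⁺ D c → ∃ λ i → w i ≡ x
  N⁺⊆w x∈N⁺ with i , cᵢ⟶x ← ∈N⁺⁻ D c x∈N⁺ with prey-of-cycle i cᵢ⟶x
  ... | inj₁ x≡wᵢ   = i , sym x≡wᵢ
  ... | inj₂ x≡wᵢ₋₁ = prev i , sym x≡wᵢ₋₁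

module PreysOffCycle {n} (D : Digraph n) (acyclic : Acyclic D)
                     (indeg≤2 : ∀ v → indeg D v ≤ 2) (outdeg≤2 : ∀ v → outdeg D v ≤ 2)
                     {k} (2≤k : 2 ≤ k) (c : Fin (suc k) → Fin n) (c-injective : Injective _≡_ _≡_ c)
                     (w : Fin (suc k) → Fin n)
                     (cᵢ⟶wᵢ : ∀ i → arc D (c i) (w i) ≡ true)
                     (cᵢ₊₁⟶wᵢ : ∀ i → arc D (c (next i)) (w i) ≡ true)
                     (z : Fin (suc k) → Fin n)
                     (zᵢ⟶cᵢ : ∀ i → arc D (z i) (c i) ≡ true)
                     (zᵢ⟶cᵢ₊₁ : ∀ i → arc D (z i) (c (next i)) ≡ true) where

  open Arcs D
  open CyclePreys D indeg≤2 outdeg≤2 2≤k c c-injective w cᵢ⟶wᵢ cᵢ₊₁⟶wᵢ public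
  open ReachOrder D acyclic c using (_≺_; ¬≺-inflationary)
  private
    1≤k : 1 ≤ k
    1≤k = <⇒≤ 2≤k

    module Z = CyclePreys (reverse D) outdeg≤2 indeg≤2 2≤k c c-injective z zᵢ⟶cᵢ zᵢ⟶cᵢ₊₁

    wᵢ₊₁-on-cycle : ∀ i {j j′} → w i ≡ c j → c (next i) ⟶ c j′ → j′ ≢ j → w (next i) ≡ c j′
    wᵢ₊₁-on-cycle i wᵢ≡cⱼ cᵢ₊₁⟶cⱼ′ j′≢j with prey-of-cycle (next i) cᵢ₊₁⟶cⱼ′
    ... | inj₁ cⱼ′≡wᵢ₊₁ = sym cⱼ′≡wᵢ₊₁
    ... | inj₂ cⱼ′≡wᵢ   = ⊥-elim (j′≢j (c-injective (trans cⱼ′≡wᵢ (trans (cong w (prev-next i)) wᵢ≡cⱼ))))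

  -- If w i = c j then c (i+1) is one of the two predators z j, z (j-1) of c j, and its prey c (j±1)
  -- can only be w (i+1).
  w-on-cycle-step : ∀ i → (∃ λ j → w i ≡ c j) → ∃ λ j → w (next i) ≡ c j
  w-on-cycle-step i (j , wᵢ≡cⱼ) with Z.prey-of-cycle j (subst (c (next i) ⟶_) wᵢ≡cⱼ (cᵢ₊₁⟶wᵢ i))
  ... | inj₁ cᵢ₊₁≡zⱼ   = next j , wᵢ₊₁-on-cycle i wᵢ≡cⱼ
                           (subst (_⟶ c (next j)) (sym cᵢ₊₁≡zⱼ) (zᵢ⟶cᵢ₊₁ j)) (next≢ 1≤k j)
  ... | inj₂ cᵢ₊₁≡zⱼ₋₁ = prev j , wᵢ₊₁-on-cycle i wᵢ≡cⱼ
                           (subst (_⟶ c (prev j)) (sym cᵢ₊₁≡zⱼ₋₁) (zᵢ⟶cᵢ (prev j))) (prev≢ 1≤k j)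

  w∉cycle : ∀ i j → c j ≢ w i
  w∉cycle i j cⱼ≡wᵢ = ¬≺-inflationary (proj₁ ∘ w-on-cycle) cᵧ≺wᵧ i
    where
    w-on-cycle : ∀ y → ∃ λ j → w y ≡ c j
    w-on-cycle = next-induction _ (j , sym cⱼ≡wᵢ) w-on-cycle-step
    cᵧ≺wᵧ : ∀ y → y ≺ proj₁ (w-on-cycle y)
    cᵧ≺wᵧ y = step (subst (c y ⟶_) (proj₂ (w-on-cycle y)) (cᵢ⟶wᵢ y))

  1+k≤∣N⁺∣ : suc k ≤ ∣ N⁺ D c ∣
  1+k≤∣N⁺∣ = injective⇒≤∣p∣ w w-injective (λ i → ∈N⁺⁺ D c i (λ j → w∉cycle i j) (cᵢ⟶wᵢ i))

module CCECycle {n} {D : Digraph n} (acyclic : Acyclic D)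
                (indeg≤2 : ∀ v → indeg D v ≤ 2) (outdeg≤2 : ∀ v → outdeg D v ≤ 2)
                {k} (2≤k : 2 ≤ k) {c : Fin (suc k) → Fin n} (c-injective : Injective _≡_ _≡_ c)
                (adjacent : ∀ i → CCEAdj D (c i) (c (next i))) where

  open Arcs D
  open ReachOrder D acyclic c using (_⇝_; _⇝?_; ⇝-wellFounded)

  private
    1≤k : 1 ≤ k
    1≤k = <⇒≤ 2≤k

    w z : Fin (suc k) → Fin n
    w i = let _ , (x , _) , _ = adjacent i in x
    z i = let _ , _ , (x , _) = adjacent i in x

    cᵢ⟶wᵢ : ∀ i → c i ⟶ w i
    cᵢ⟶wᵢ i = let _ , (_ , cᵢ⟶x , _) , _ = adjacent i in cᵢ⟶x

    cᵢ₊₁⟶wᵢ : ∀ i → c (next i) ⟶ w i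
    cᵢ₊₁⟶wᵢ i = let _ , (_ , _ , cᵢ₊₁⟶x) , _ = adjacent i in cᵢ₊₁⟶x

    zᵢ⟶cᵢ : ∀ i → z i ⟶ c i
    zᵢ⟶cᵢ i = let _ , _ , (_ , x⟶cᵢ , _) = adjacent i in x⟶cᵢ

    zᵢ⟶cᵢ₊₁ : ∀ i → z i ⟶ c (next i)
    zᵢ⟶cᵢ₊₁ i = let _ , _ , (_ , _ , x⟶cᵢ₊₁) = adjacent i in x⟶cᵢ₊₁

  module W = PreysOffCycle D acyclic indeg≤2 outdeg≤2 2≤k c c-injective
               w cᵢ⟶wᵢ cᵢ₊₁⟶wᵢ z zᵢ⟶cᵢ zᵢ⟶cᵢ₊₁
  -- N⁺ (reverse D) c is N⁻ D c by definition, so Z's statements about N⁺ are about N⁻.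
  module Z = PreysOffCycle (reverse D) (reverse-acyclic acyclic) outdeg≤2 indeg≤2 2≤k c c-injective
               z zᵢ⟶cᵢ zᵢ⟶cᵢ₊₁ w cᵢ⟶wᵢ cᵢ₊₁⟶wᵢ

  ∃-two-sources : ∃₂ λ a a′ → a′ ≢ a × (∀ {u} → ¬ u ⇝ a) × (∀ {u} → u ≢ a → ¬ u ⇝ a′)
  ∃-two-sources
    with a , _ , a-source ← wf⇒∃-minimal ⇝-wellFounded _⇝?_ {Q = λ _ → ⊤} (λ _ → yes tt) {zero} tt
    with a′ , a′≢a , a′-source ← wf⇒∃-minimal ⇝-wellFounded _⇝?_ (λ u → ¬? (u ≟ a)) (next≢ 1≤k a)
    = a , a′ , a′≢a , a-source tt , a′-source

  z-into : Fin (suc k) → Subset (suc k)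
  z-into a = tabulate λ e → arc D (z e) (c a)

  ∈z-into⁺ : ∀ {a e} → z e ⟶ c a → e ∈ z-into a
  ∈z-into⁺ {a} = ∈tabulate⁺ (λ e → arc D (z e) (c a))

  ∈z-into⁻ : ∀ {a e} → e ∈ z-into a → z e ⟶ c a
  ∈z-into⁻ {a} = ∈tabulate⁻ (λ e → arc D (z e) (c a))

  z-into-sources-not-prey : ∀ {a a′ e} i → (∀ {u} → ¬ u ⇝ a) → (∀ {u} → u ≢ a → ¬ u ⇝ a′) →
                            e ∈ z-into a ∪ z-into a′ → z e ≢ w i
  z-into-sources-not-prey {a} {a′} {e} i a-source a′-source e∈ zₑ≡wᵢ
    with x∈p∪q⁻ (z-into a) (z-into a′) e∈
  ... | inj₁ e∈z-into-a = a-source (z e , subst (c i ⟶_) (sym zₑ≡wᵢ) (cᵢ⟶wᵢ i) , ∈z-into⁻ e∈z-into-a)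
  ... | inj₂ e∈z-into-a′ with i ≟ a
  ...   | yes refl = a′-source (next≢ 1≤k i)
                       (z e , subst (c (next i) ⟶_) (sym zₑ≡wᵢ) (cᵢ₊₁⟶wᵢ i) , ∈z-into⁻ e∈z-into-a′)
  ...   | no  i≢a  = a′-source i≢a
                       (z e , subst (c i ⟶_) (sym zₑ≡wᵢ) (cᵢ⟶wᵢ i) , ∈z-into⁻ e∈z-into-a′)

  3≤∣z-into∪z-into∣ : ∀ {a a′} → a′ ≢ a → 3 ≤ ∣ z-into a ∪ z-into a′ ∣
  3≤∣z-into∪z-into∣ {a} {a′} a′≢a = prev-pairs⇒3≤∣p∣ 2≤k a′≢a
    (x∈p∪q⁺ (inj₁ (∈z-into⁺ (zᵢ⟶cᵢ a))))  (x∈p∪q⁺ (inj₁ (∈z-into⁺ (zᵢ₋₁⟶cᵢ a))))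
    (x∈p∪q⁺ (inj₂ (∈z-into⁺ (zᵢ⟶cᵢ a′)))) (x∈p∪q⁺ (inj₂ (∈z-into⁺ (zᵢ₋₁⟶cᵢ a′))))
    where
    zᵢ₋₁⟶cᵢ : ∀ i → z (prev i) ⟶ c i
    zᵢ₋₁⟶cᵢ i = subst (λ j → z (prev i) ⟶ c j) (next-prev i) (zᵢ⟶cᵢ₊₁ (prev i))

  N⁺∩N⁻⊆z[∁z-into] : ∀ {a a′} → (∀ {u} → ¬ u ⇝ a) → (∀ {u} → u ≢ a → ¬ u ⇝ a′) →
                      ∀ {x} → x ∈ N⁺ D c ∩ N⁻ D c → ∃ λ e → e ∈ ∁ (z-into a ∪ z-into a′) × z e ≡ x
  N⁺∩N⁻⊆z[∁z-into] a-source a′-source x∈N⁺∩N⁻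
    with x∈N⁺ , x∈N⁻ ← x∈p∩q⁻ (N⁺ D c) (N⁻ D c) x∈N⁺∩N⁻
    with i , wᵢ≡x ← W.N⁺⊆w x∈N⁺ | e , zₑ≡x ← Z.N⁺⊆w x∈N⁻ =
    e , x∉p⇒x∈∁p (λ e∈ → z-into-sources-not-prey i a-source a′-source e∈ (trans zₑ≡x (sym wᵢ≡x))) , zₑ≡x

  sources⇒∣N⁺∩N⁻∣≤1+k∸3 : ∀ {a a′} → a′ ≢ a → (∀ {u} → ¬ u ⇝ a) → (∀ {u} → u ≢ a → ¬ u ⇝ a′) →
                           ∣ N⁺ D c ∩ N⁻ D c ∣ ≤ suc k ∸ 3
  sources⇒∣N⁺∩N⁻∣≤1+k∸3 {a} {a′} a′≢a a-source a′-source = begin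
    ∣ N⁺ D c ∩ N⁻ D c ∣               ≤⟨ covered⇒∣p∣≤∣q∣ z (N⁺∩N⁻⊆z[∁z-into] a-source a′-source) ⟩
    ∣ ∁ (z-into a ∪ z-into a′) ∣      ≡⟨ ∣∁p∣≡n∸∣p∣ (z-into a ∪ z-into a′) ⟩
    suc k ∸ ∣ z-into a ∪ z-into a′ ∣  ≤⟨ ∸-monoʳ-≤ (suc k) (3≤∣z-into∪z-into∣ a′≢a) ⟩
    suc k ∸ 3                         ∎
    where open ≤-Reasoning

  ∣N⁺∩N⁻∣≤1+k∸3 : ∣ N⁺ D c ∩ N⁻ D c ∣ ≤ suc k ∸ 3
  ∣N⁺∩N⁻∣≤1+k∸3 =
    let _ , _ , a′≢a , a-source , a′-source = ∃-two-sources
    in sources⇒∣N⁺∩N⁻∣≤1+k∸3 a′≢a a-source a′-source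

lemma4p6 : ∀ {n} (D : Digraph n) → Is22 D →
    (m : ℕ) (c : Fin m → Fin n) → IsCCECycle D m c →
    (m + 3 ≤ ∣ N⁺ D c ∪ N⁻ D c ∣) × (∣ N⁺ D c ∩ N⁻ D c ∣ ≤ m ∸ 3)
lemma4p6 D _ zero c (() , _)
lemma4p6 D (acyclic , indeg≤2 , outdeg≤2) (suc k) c (s≤s 2≤k , c-injective , adjacent) =
  m+3≤∣p∪q∣ (N⁺ D c) (N⁻ D c) W.1+k≤∣N⁺∣ Z.1+k≤∣N⁺∣ ∣N⁺∩N⁻∣≤1+k∸3 (s≤s 2≤k) , ∣N⁺∩N⁻∣≤1+k∸3
  where open CCECycle acyclic indeg≤2 outdeg≤2 2≤k c-injective adjacent
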